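{- Let $n\geq 3$. (a) If $2\leq k\leq \lceil n/2\rceil$, then any two distinct trees on the same $n$-vertex vertex set have distinct families of connected $k$-sets. (b) If $\lceil n/2\rceil+1\leq k\leq n$, then for every path $P$ on an $n$-vertex vertex set $V$ there is a path $P'\neq P$ on vertex set $V$ with the same family of connected $k$-sets as $P$.
   Context: For a graph $G=(V,E)$ and $k\geq 2$, the connected $k$-sets of $G$ are the sets $X\subseteq V$ with $|X|=k$ such that $G[X]$ is connected. Graphs are labelled: two graphs on the same vertex set are equal iff they have the same edge set. -}

module Defs where

open import Data.Nat using (ℕ; zero; suc; _+_; _∸_; _<_; _≤_; _/_)
open import Data.Bool using (Bool; true; false; T)
open import Data.Fin using (Fin; toℕ)
open import Data.Fin.Subset using (Subset; _∈_; ∣_∣; ⊤)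
open import Data.List using (List; []; _∷_; length; filter; allFin; cartesianProduct)
open import Data.List.Relation.Unary.All using (All)
open import Data.Product using (Σ; _×_; _,_; proj₁; proj₂; ∃)
open import Data.Sum using (_⊎_)
open import Relation.Binary.PropositionalEquality using (_≡_; _≢_)
open import Relation.Nullary using (¬_)
open import Relation.Nullary.Decidable using (Dec)
open import Function.Bundles using (_⇔_; _⤖_; Bijection)
open import Data.Fin using (_<?_)

⌈_/2⌉ : ℕ → ℕ
⌈ n /2⌉ = (n + 1) / 2

record Graph (n : ℕ) : Set where
  field
    adj   : Fin n → Fin n → Bool
    sym   : ∀ x y → adj x y ≡ adj y x
    irrefl : ∀ x → adj x x ≡ false
open Graph public

Adj : ∀ {n} → Graph n → Fin n → Fin n → Set
Adj G x y = T (adj G x y)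

-- Labelled graphs are equal iff they have the same edge set.
SameEdges : ∀ {n} → Graph n → Graph n → Set
SameEdges G H = ∀ x y → adj G x y ≡ adj H x y

data WalkIn {n : ℕ} (G : Graph n) (X : Subset n) : Fin n → Fin n → Set where
  here : ∀ {x} → x ∈ X → WalkIn G X x x
  step : ∀ {x y z} → x ∈ X → Adj G x y → WalkIn G X y z → WalkIn G X x z

-- G[X] is connected (X nonempty is guaranteed below by |X| = k ≥ 2).
InducedConnected : ∀ {n} → Graph n → Subset n → Set
InducedConnected G X = ∀ x y → x ∈ X → y ∈ X → WalkIn G X x y

ConnectedKSet : ∀ {n} → ℕ → Graph n → Subset n → Set
ConnectedKSet k G X = (∣ X ∣ ≡ k) × InducedConnected G X

SameConnectedKSets : ∀ {n} → ℕ → Graph n → Graph n → Set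
SameConnectedKSets k G H = ∀ X → ConnectedKSet k G X ⇔ ConnectedKSet k H X

Connected : ∀ {n} → Graph n → Set
Connected {n} G = ∀ x y → WalkIn G ⊤ x y

numEdges : ∀ {n} → Graph n → ℕ
numEdges {n} G =
  length (filter (λ p → Data.Bool._≟_ (adj G (proj₁ p) (proj₂ p)) true)
                 (filter (λ p → proj₁ p <? proj₂ p)
                         (cartesianProduct (allFin n) (allFin n))))
  where import Data.Bool

IsTree : ∀ {n} → Graph n → Set
IsTree {n} G = Connected G × (numEdges G ≡ n ∸ 1)

Consecutive : ℕ → ℕ → Set
Consecutive i j = (suc i ≡ j) ⊎ (suc j ≡ i)

IsPath : ∀ {n} → Graph n → Set
IsPath {n} G = Σ (Fin n ⤖ Fin n) λ σ →
  ∀ i j → Adj G (Bijection.to σ i) (Bijection.to σ j) ⇔ Consecutive (toℕ i) (toℕ j)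

{-# OPTIONS --safe #-}
-- (a) Connected 2-sets are edges, so it suffices to descend from k to 2: if two trees on
-- n ≥ 2k + 1 vertices have the same connected (k+1)-sets, they have the same connected
-- k-sets. Let Y be a connected k-set of T₁ and y₁a a T₁-edge leaving it. Y ∪ {a} is
-- connected in T₂, so Y is too unless a has two T₂-neighbours in Y. In that case y₁a is the
-- only T₁-edge leaving Y (another one, yb, would make Y ∪ {b} connected in T₂, closing a
-- cycle through a), so every T₁-connected set meeting both Y and its complement contains y₁
-- and a. Grow {a, c}, for a T₂-neighbour c ≠ y₁ of a in Y, inside T₂ − y₁. Reaching k + 1
-- vertices yields such a set (connected in T₁ too) without y₁. Getting stuck yields a branch
-- C ∋ a of T₂ at y₁ with at most k vertices; then T₂ − C is connected and contains a
-- connected (k+1)-set through y₁ avoiding a, which is therefore inside Y, but Y is too small.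
--
-- (b) With m = n − k ≤ k − 2, every connected k-set of a path (an interval of k positions)
-- contains the vertices at positions m and m + 1. Exchanging these two vertices gives a
-- different path, and the ends of any edge of either path are joined in the other directly or
-- through one of the two exchanged vertices.

module Submission where

open import Defs hiding (sym)
open import Data.Bool using (Bool; true; T; _∧_; _∨_; not)
open import Data.Bool.Properties using (T?; T-≡; T-∧; ∨-comm; ∧-comm; ⇔→≡) renaming (_≟_ to _≟ᵇ_)
open import Data.Empty using (⊥; ⊥-elim)
open import Data.Fin using (Fin; zero; suc; toℕ; fromℕ<; _<?_) renaming (_<_ to _<ᶠ_; _≟_ to _≟ᶠ_)
open import Data.Fin.Permutation
  using (Permutation′; _⟨$⟩ʳ_; _⟨$⟩ˡ_; inverseˡ; inverseʳ; flip; _∘ₚ_; transpose)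
open import Data.Fin.Properties using (any?; toℕ-fromℕ<; injective⇒≤; toℕ-injective; toℕ<n)
  renaming (≤∧≢⇒< to ≤∧≢⇒<ᶠ; suc-injective to Fin-suc-injective)
open import Data.Fin.Subset using (Subset; _∈_; _∉_; _⊆_; ∣_∣; ⊤; ⁅_⁆; _∪_; ∁; inside; outside)
open import Data.Fin.Subset.Properties
  using (_∈?_; ∈⊤; x∈⁅x⁆; x∈⁅y⁆⇒x≡y; x≢y⇒x∉⁅y⁆; ∣⁅x⁆∣≡1; x∈p∪q⁺; x∈p∪q⁻; ∪-identityʳ;
         x∈∁p⇒x∉p; x∉p⇒x∈∁p; x∉∁p⇒x∈p; ∣∁p∣≡n∸∣p∣; ∣⊤∣≡n; p⊆q⇒∣p∣≤∣q∣; nonempty?)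
open import Data.List using (List; length; filter; allFin; cartesianProduct; lookup)
open import Data.List.Membership.Propositional using () renaming (_∈_ to _∈ₗ_; _∉_ to _∉ₗ_)
open import Data.List.Membership.Propositional.Properties
  using (∈-filter⁺; ∈-filter⁻; ∈-cartesianProduct⁺; ∈-allFin)
open import Data.List.Relation.Binary.Sublist.Propositional
  using (_∷ʳ_; _∷_; ⊆-refl) renaming (_⊆_ to _⊆ₗ_)
open import Data.List.Relation.Binary.Sublist.Propositional.Properties using (length-mono-≤; filter⁺)
open import Data.List.Relation.Unary.Any using (here; there; index)
open import Data.List.Relation.Unary.Any.Properties using (lookup-index)
open import Data.Nat using (ℕ; zero; suc; _+_; _*_; _∸_; _≤_; _<_; z≤n; s≤s) renaming (_<?_ to _<ℕ?_)
open import Data.Nat.DivMod using (_%_; m≡m%n+[m/n]*n; m%n<n)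
open import Data.Nat.Properties
  using (_≟_; suc-injective; 1+n≢n; >⇒≢; ≤-reflexive; ≤-antisym; ≤-trans; ≤-pred; <-irrefl; <-trans;
         <-≤-trans; <⇒≤; <⇒≱; ≮⇒≥; ≰⇒>; ≤∧≢⇒<; n≤1+n; n<1+n; m≤n⇒m≤1+n; m<n⇒m<1+n; m≤m+n; m≤n+m;
         +-suc; +-comm; +-identityʳ; *-comm; +-mono-≤; +-monoˡ-≤; +-monoʳ-≤; +-cancelʳ-≤;
         m∸n+n≡m; ∸-monoˡ-<; ∸-cancelʳ-≡; m+n≤o⇒m≤o∸n; m≤o∸n⇒m+n≤o)
open import Data.Nat.Tactic.RingSolver using (solve-∀)
open import Data.Product using (Σ; ∃; ∃₂; _×_; _,_; proj₁; proj₂)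
open import Data.Sum using (_⊎_; inj₁; inj₂) renaming (swap to swapᵤ)
open import Data.Unit using (tt)
open import Data.Vec using (_∷_; here; there)
open import Function using (_∘_; _$_)
open import Function.Bundles using (Equivalence; mk⇔; _⇔_)
open import Function.Properties.Bijection using (⤖⇒↔)
open import Function.Properties.Equivalence using () renaming (sym to ⇔-sym; trans to ⇔-trans)
open import Function.Properties.Inverse using (↔⇒⤖)
open import Relation.Binary.PropositionalEquality
  using (_≡_; _≢_; refl; sym; trans; cong; cong₂; subst; subst₂; module ≡-Reasoning)
open import Relation.Nullary using (¬_; Dec; yes; no; contradiction)
open import Relation.Nullary.Decidable
  using (does; isYes; isYes≗does; toWitness; fromWitness; dec-true; dec-false; decidable-stable;
         _×-dec_; _⊎-dec_; ¬?)

private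
  variable
    n : ℕ

T-injective : {a b : Bool} → T a ⇔ T b → a ≡ b
T-injective a⇔b = ⇔→≡ (⇔-trans (⇔-sym T-≡) (⇔-trans a⇔b T-≡))

∣p∪⁅x⁆∣≡1+∣p∣ : {p : Subset n} {x : Fin n} → x ∉ p → ∣ p ∪ ⁅ x ⁆ ∣ ≡ suc ∣ p ∣
∣p∪⁅x⁆∣≡1+∣p∣ {p = inside ∷ p}  {zero}  x∉p = contradiction here x∉p
∣p∪⁅x⁆∣≡1+∣p∣ {p = outside ∷ p} {zero}  _   = cong (suc ∘ ∣_∣) (∪-identityʳ p)
∣p∪⁅x⁆∣≡1+∣p∣ {p = inside ∷ p}  {suc x} x∉p = cong suc (∣p∪⁅x⁆∣≡1+∣p∣ (x∉p ∘ there))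
∣p∪⁅x⁆∣≡1+∣p∣ {p = outside ∷ p} {suc x} x∉p = ∣p∪⁅x⁆∣≡1+∣p∣ (x∉p ∘ there)

x∈p∪⁅x⁆ : {p : Subset n} (x : Fin n) → x ∈ p ∪ ⁅ x ⁆
x∈p∪⁅x⁆ x = x∈p∪q⁺ (inj₂ (x∈⁅x⁆ x))

p⊆p∪⁅x⁆ : {p : Subset n} {x : Fin n} → p ⊆ p ∪ ⁅ x ⁆
p⊆p∪⁅x⁆ = x∈p∪q⁺ ∘ inj₁

x∈p∪⁅y⁆⁻ : {p : Subset n} {x y : Fin n} → x ∈ p ∪ ⁅ y ⁆ → x ∈ p ⊎ x ≡ y
x∈p∪⁅y⁆⁻ {p = p} {y = y} x∈ with x∈p∪q⁻ p ⁅ y ⁆ x∈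
... | inj₁ x∈p  = inj₁ x∈p
... | inj₂ x∈⁅y⁆ = inj₂ (x∈⁅y⁆⇒x≡y y x∈⁅y⁆)

⊆-or-∃∉ : (p q : Subset n) → p ⊆ q ⊎ ∃ λ x → x ∈ p × x ∉ q
⊆-or-∃∉ p q with any? (λ x → (x ∈? p) ×-dec ¬? (x ∈? q))
... | yes (x , x∈p , x∉q) = inj₂ (x , x∈p , x∉q)
... | no none = inj₁ λ {x} x∈p → decidable-stable (x ∈? q) λ x∉q → none (x , x∈p , x∉q)

enumerate : (p : Subset n) → Fin ∣ p ∣ → Fin n
enumerate (inside ∷ p)  zero    = zero
enumerate (inside ∷ p)  (suc i) = suc (enumerate p i)
enumerate (outside ∷ p) i       = suc (enumerate p i)

enumerate-∈ : (p : Subset n) (i : Fin ∣ p ∣) → enumerate p i ∈ p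
enumerate-∈ (inside ∷ p)  zero    = here
enumerate-∈ (inside ∷ p)  (suc i) = there (enumerate-∈ p i)
enumerate-∈ (outside ∷ p) i       = there (enumerate-∈ p i)

enumerate-injective : (p : Subset n) {i j : Fin ∣ p ∣} → enumerate p i ≡ enumerate p j → i ≡ j
enumerate-injective (inside ∷ p)  {zero}  {zero}  _ = refl
enumerate-injective (inside ∷ p)  {suc i} {suc j} e = cong suc (enumerate-injective p (Fin-suc-injective e))
enumerate-injective (outside ∷ p) e = enumerate-injective p (Fin-suc-injective e)

∣p∣≤-of-injective-into-interval : (p : Subset n) (f : Fin n → ℕ) {lo hi : ℕ} →
  (∀ {x y} → x ∈ p → y ∈ p → f x ≡ f y → x ≡ y) →
  (∀ {x} → x ∈ p → lo ≤ f x × f x < hi) → ∣ p ∣ ≤ hi ∸ lo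
∣p∣≤-of-injective-into-interval p f {lo} {hi} f-inj f-∈ = injective⇒≤ {f = shifted} shifted-injective
  where
  bounds : ∀ i → lo ≤ f (enumerate p i) × f (enumerate p i) < hi
  bounds i = f-∈ (enumerate-∈ p i)
  shifted : Fin ∣ p ∣ → Fin (hi ∸ lo)
  shifted i = fromℕ< (∸-monoˡ-< (proj₂ (bounds i)) (proj₁ (bounds i)))
  shifted-injective : ∀ {i j} → shifted i ≡ shifted j → i ≡ j
  shifted-injective {i} {j} e = enumerate-injective p $ f-inj (enumerate-∈ p i) (enumerate-∈ p j) $
    ∸-cancelʳ-≡ (proj₁ (bounds i)) (proj₁ (bounds j)) $
      trans (sym (toℕ-fromℕ< _)) (trans (cong toℕ e) (toℕ-fromℕ< _))

-- Walks and induced connectivity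

Adj-sym : (G : Graph n) {x y : Fin n} → Adj G x y → Adj G y x
Adj-sym G {x} {y} = subst T (Graph.sym G x y)

Adj⇒≢ : (G : Graph n) {x y : Fin n} → Adj G x y → x ≢ y
Adj⇒≢ G {x} e refl = subst T (Graph.irrefl G x) e

module _ {G : Graph n} {X : Subset n} where

  walk-head : ∀ {x y} → WalkIn G X x y → x ∈ X
  walk-head (here x∈)     = x∈
  walk-head (step x∈ _ _) = x∈

  infixr 5 _++ʷ_
  _++ʷ_ : ∀ {x y z} → WalkIn G X x y → WalkIn G X y z → WalkIn G X x z
  here _      ++ʷ w′ = w′
  step x∈ e w ++ʷ w′ = step x∈ e (w ++ʷ w′)

  edgeʷ : ∀ {x y} → x ∈ X → y ∈ X → Adj G x y → WalkIn G X x y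
  edgeʷ x∈ y∈ e = step x∈ e (here y∈)

  reverseʷ : ∀ {x y} → WalkIn G X x y → WalkIn G X y x
  reverseʷ (here x∈)     = here x∈
  reverseʷ (step x∈ e w) = reverseʷ w ++ʷ edgeʷ (walk-head w) x∈ (Adj-sym G e)

reroute : {G H : Graph n} {X X′ : Subset n} →
  (∀ {x y} → x ∈ X → y ∈ X → Adj G x y → WalkIn H X′ x y) → X ⊆ X′ →
  ∀ {a b} → WalkIn G X a b → WalkIn H X′ a b
reroute edge X⊆X′ (here a∈)     = here (X⊆X′ a∈)
reroute edge X⊆X′ (step a∈ e w) = edge a∈ (walk-head w) e ++ʷ reroute edge X⊆X′ w

walk-⊆ : {G : Graph n} {X X′ : Subset n} → X ⊆ X′ → ∀ {a b} → WalkIn G X a b → WalkIn G X′ a b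
walk-⊆ X⊆X′ = reroute (λ x∈ y∈ → edgeʷ (X⊆X′ x∈) (X⊆X′ y∈)) X⊆X′

reroute-connected : {G H : Graph n} {X : Subset n} →
  (∀ {x y} → x ∈ X → y ∈ X → Adj G x y → WalkIn H X x y) →
  InducedConnected G X → InducedConnected H X
reroute-connected edge conn x y x∈ y∈ = reroute edge (λ x∈ → x∈) (conn x y x∈ y∈)

SameEdges⇒ConnectedKSet : {G H : Graph n} → SameEdges G H → ∀ {k X} →
  ConnectedKSet k G X → ConnectedKSet k H X
SameEdges⇒ConnectedKSet same (size , conn) =
  size , reroute-connected (λ {x} {y} x∈ y∈ e → edgeʷ x∈ y∈ (subst T (same x y) e)) conn

module _ (G : Graph n) where

  crossing-edge : ∀ {X Y s t} → WalkIn G X s t → s ∈ Y → t ∉ Y →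
    ∃₂ λ x x′ → x ∈ Y × x′ ∉ Y × Adj G x x′ × x ∈ X × x′ ∈ X
  crossing-edge (here _) s∈Y t∉Y = contradiction s∈Y t∉Y
  crossing-edge {Y = Y} (step {y = s′} s∈X e w) s∈Y t∉Y with s′ ∈? Y
  ... | yes s′∈Y = crossing-edge w s′∈Y t∉Y
  ... | no  s′∉Y = _ , _ , s∈Y , s′∉Y , e , s∈X , walk-head w

  ⁅x⁆-connected : (x : Fin n) → InducedConnected G ⁅ x ⁆
  ⁅x⁆-connected x y z y∈ z∈ with x∈⁅y⁆⇒x≡y x y∈ | x∈⁅y⁆⇒x≡y x z∈
  ... | refl | refl = here y∈

  ∪⁅⁆-connected : ∀ {S x z} → InducedConnected G S → x ∈ S → Adj G x z →
    InducedConnected G (S ∪ ⁅ z ⁆)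
  ∪⁅⁆-connected {S} {x} {z} conn x∈S e a b a∈ b∈ with x∈p∪⁅y⁆⁻ a∈ | x∈p∪⁅y⁆⁻ b∈
  ... | inj₁ a∈S  | inj₁ b∈S  = walk-⊆ p⊆p∪⁅x⁆ (conn a b a∈S b∈S)
  ... | inj₂ refl | inj₂ refl = here a∈
  ... | inj₂ refl | inj₁ b∈S  = step a∈ (Adj-sym G e) (walk-⊆ p⊆p∪⁅x⁆ (conn x b x∈S b∈S))
  ... | inj₁ a∈S  | inj₂ refl = walk-⊆ p⊆p∪⁅x⁆ (conn a x a∈S x∈S) ++ʷ edgeʷ (p⊆p∪⁅x⁆ x∈S) b∈ e

  ∪⁅⁆-connected⁻ : ∀ {Y b} → b ∉ Y →
    (∀ {p q} → p ∈ Y → q ∈ Y → Adj G b p → Adj G b q → p ≡ q) →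
    InducedConnected G (Y ∪ ⁅ b ⁆) → InducedConnected G Y
  ∪⁅⁆-connected⁻ {Y} {b} b∉Y unique conn x y x∈ y∈ = avoid (conn x y (p⊆p∪⁅x⁆ x∈) (p⊆p∪⁅x⁆ y∈)) x∈ y∈
    where
    avoid : ∀ {x y} → WalkIn G (Y ∪ ⁅ b ⁆) x y → x ∈ Y → y ∈ Y → WalkIn G Y x y
    avoid (here _) x∈ _ = here x∈
    avoid (step _ e w) x∈ y∈ with x∈p∪⁅y⁆⁻ (walk-head w)
    ... | inj₁ x′∈Y = step x∈ e (avoid w x′∈Y y∈)
    avoid (step _ e (here _)) x∈ y∈ | inj₂ refl = contradiction y∈ b∉Y
    avoid (step _ e (step _ e′ w)) x∈ y∈ | inj₂ refl with x∈p∪⁅y⁆⁻ (walk-head w)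
    ... | inj₂ refl = contradiction refl (Adj⇒≢ G e′)
    ... | inj₁ x″∈Y = subst (λ v → WalkIn G Y v _) (unique x″∈Y x∈ e′ (Adj-sym G e)) (avoid w x″∈Y y∈)

  ClosedIn : Subset n → Subset n → Set
  ClosedIn U S = ∀ {x z} → x ∈ S → Adj G x z → z ∈ U → z ∈ S

  closed-absorbs : ∀ {U S r t} → ClosedIn U S → WalkIn G U r t → t ∈ S → r ∈ S
  closed-absorbs closed (here _) t∈S = t∈S
  closed-absorbs closed (step r∈U e w) t∈S = closed (closed-absorbs closed w t∈S) (Adj-sym G e) r∈U

  walk-to-gate : ∀ {h C X r t} → ClosedIn (∁ ⁅ h ⁆) C → WalkIn G X r t → r ∉ C → t ∈ C →
    WalkIn G (∁ C) r h
  walk-to-gate closed (here _) r∉C t∈C = contradiction t∈C r∉C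
  walk-to-gate {h} {C} closed (step {y = r′} _ e w) r∉C t∈C with r′ ∈? C
  ... | no r′∉C = step (x∉p⇒x∈∁p r∉C) e (walk-to-gate closed w r′∉C t∈C)
  ... | yes r′∈C with x∈⁅y⁆⇒x≡y h (x∉∁p⇒x∈p (r∉C ∘ closed r′∈C (Adj-sym G e)))
  ...   | refl = here (x∉p⇒x∈∁p r∉C)

  ∁-connected : ∀ {h C c} → Connected G → ClosedIn (∁ ⁅ h ⁆) C → c ∈ C → InducedConnected G (∁ C)
  ∁-connected {h} {C} {c} conn closed c∈C x y x∈ y∈ = to-gate x∈ ++ʷ reverseʷ (to-gate y∈)
    where
    to-gate : ∀ {r} → r ∈ ∁ C → WalkIn G (∁ C) r h
    to-gate {r} r∈ = walk-to-gate closed (conn r c) (x∈∁p⇒x∉p r∈) c∈C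

  data Growth (U S : Subset n) (m : ℕ) : Set where
    reached : (X : Subset n) → InducedConnected G X → S ⊆ X → X ⊆ U → ∣ X ∣ ≡ m → Growth U S m
    stuck   : (C : Subset n) → InducedConnected G C → S ⊆ C → C ⊆ U → ∣ C ∣ < m → ClosedIn U C →
              Growth U S m

  grow : ∀ d {U S} → InducedConnected G S → S ⊆ U → Growth U S (d + ∣ S ∣)
  grow zero {S = S} conn S⊆U = reached S conn (λ x∈ → x∈) S⊆U refl
  grow (suc d) {U} {S} conn S⊆U
    with any? (λ x → any? (λ z → (x ∈? S) ×-dec (¬? (z ∈? S) ×-dec ((z ∈? U) ×-dec T? (adj G x z)))))
  ... | yes (x , z , x∈S , z∉S , z∈U , e) =
    shrink (subst (Growth U (S ∪ ⁅ z ⁆)) size (grow d (∪⁅⁆-connected conn x∈S e) S∪z⊆U))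
    where
    size : d + ∣ S ∪ ⁅ z ⁆ ∣ ≡ suc d + ∣ S ∣
    size = trans (cong (d +_) (∣p∪⁅x⁆∣≡1+∣p∣ z∉S)) (+-suc d ∣ S ∣)
    S∪z⊆U : S ∪ ⁅ z ⁆ ⊆ U
    S∪z⊆U y∈ with x∈p∪⁅y⁆⁻ y∈
    ... | inj₁ y∈S = S⊆U y∈S
    ... | inj₂ refl = z∈U
    shrink : ∀ {m} → Growth U (S ∪ ⁅ z ⁆) m → Growth U S m
    shrink (reached X connX S⊆X X⊆U sizeX)        = reached X connX (S⊆X ∘ p⊆p∪⁅x⁆) X⊆U sizeX
    shrink (stuck C connC S⊆C C⊆U sizeC closedC) = stuck C connC (S⊆C ∘ p⊆p∪⁅x⁆) C⊆U sizeC closedC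
  ... | no none = stuck S conn (λ x∈ → x∈) S⊆U (s≤s (m≤n+m ∣ S ∣ d)) closed
    where
    closed : ClosedIn U S
    closed {x} {z} x∈S e z∈U = decidable-stable (z ∈? S) λ z∉S → none (x , z , x∈S , z∉S , z∈U , e)

  connected-subset-of-size : ∀ {R S s} → InducedConnected G R → InducedConnected G S → S ⊆ R → s ∈ S →
    ∀ d → d + ∣ S ∣ ≤ ∣ R ∣ → ∃ λ X → InducedConnected G X × S ⊆ X × X ⊆ R × ∣ X ∣ ≡ d + ∣ S ∣
  connected-subset-of-size {R} {S} {s} connR connS S⊆R s∈S d fits with grow d connS S⊆R
  ... | reached X connX S⊆X X⊆R size = X , connX , S⊆X , X⊆R , size
  ... | stuck C _ S⊆C C⊆R size closed with ⊆-or-∃∉ R C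
  ...   | inj₁ R⊆C = contradiction (≤-trans fits (p⊆q⇒∣p∣≤∣q∣ R⊆C)) (<⇒≱ size)
  ...   | inj₂ (r , r∈R , r∉C) = contradiction (closed-absorbs closed (connR r s r∈R (S⊆R s∈S)) (S⊆C s∈S)) r∉C

-- Edge counts and trees

length-mono-< : {A : Set} {xs ys : List A} {y : A} → xs ⊆ₗ ys → y ∈ₗ ys → y ∉ₗ xs → length xs < length ys
length-mono-< (_ ∷ʳ xs⊆ys) (here refl)  _    = s≤s (length-mono-≤ xs⊆ys)
length-mono-< (_ ∷ʳ xs⊆ys) (there y∈ys) y∉xs = m≤n⇒m≤1+n (length-mono-< xs⊆ys y∈ys y∉xs)
length-mono-< (refl ∷ _)   (here refl)  y∉xs = contradiction (here refl) y∉xs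
length-mono-< (refl ∷ xs⊆ys) (there y∈ys) y∉xs = s≤s (length-mono-< xs⊆ys y∈ys (y∉xs ∘ there))

least-witness : {P : ℕ → Set} → (∀ l → Dec (P l)) → ∀ {m} → P m → ∃ λ l → P l × (∀ {j} → P j → l ≤ j)
least-witness P? {zero} p = zero , p , λ _ → z≤n
least-witness P? {suc m} p with P? zero
... | yes p₀ = zero , p₀ , λ _ → z≤n
... | no ¬p₀ with least-witness (P? ∘ suc) {m} p
...   | l , pₗ , least = suc l , pₗ , λ { {zero} p₀ → contradiction p₀ ¬p₀ ; {suc j} pⱼ → s≤s (least pⱼ) }

isOrdered? : (e : Fin n × Fin n) → Dec (proj₁ e <ᶠ proj₂ e)
isOrdered? e = proj₁ e <? proj₂ e

isEdge? : (G : Graph n) (e : Fin n × Fin n) → Dec (adj G (proj₁ e) (proj₂ e) ≡ true)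
isEdge? G e = adj G (proj₁ e) (proj₂ e) ≟ᵇ true

orderedPairs : (n : ℕ) → List (Fin n × Fin n)
orderedPairs n = filter isOrdered? (cartesianProduct (allFin n) (allFin n))

-- `numEdges G` unfolds to `length (edgeList G)`.
edgeList : Graph n → List (Fin n × Fin n)
edgeList {n} G = filter (isEdge? G) (orderedPairs n)

ordered : Fin n → Fin n → Fin n × Fin n
ordered x y with x <? y
... | yes _ = x , y
... | no  _ = y , x

ordered-injective : {a b c d : Fin n} → ordered a b ≡ ordered c d → (a ≡ c × b ≡ d) ⊎ (a ≡ d × b ≡ c)
ordered-injective {a = a} {b} {c} {d} eq with a <? b | c <? d
... | yes _ | yes _ = inj₁ (cong proj₁ eq , cong proj₂ eq)
... | yes _ | no  _ = inj₂ (cong proj₁ eq , cong proj₂ eq)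
... | no  _ | yes _ = inj₂ (cong proj₂ eq , cong proj₁ eq)
... | no  _ | no  _ = inj₁ (cong proj₂ eq , cong proj₁ eq)

module _ (G : Graph n) where

  ∈-edgeList : ∀ {x y} → x <ᶠ y → Adj G x y → (x , y) ∈ₗ edgeList G
  ∈-edgeList {x} {y} x<y e =
    ∈-filter⁺ (isEdge? G) (∈-filter⁺ isOrdered? (∈-cartesianProduct⁺ (∈-allFin x) (∈-allFin y)) x<y)
      (Equivalence.to T-≡ e)

  ∈-edgeList⁻ : ∀ {x y} → (x , y) ∈ₗ edgeList G → Adj G x y
  ∈-edgeList⁻ = Equivalence.from T-≡ ∘ proj₂ ∘ ∈-filter⁻ (isEdge? G) {xs = orderedPairs _}

  ordered-∈-edgeList : ∀ {x y} → Adj G x y → ordered x y ∈ₗ edgeList G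
  ordered-∈-edgeList {x} {y} e with x <? y
  ... | yes x<y = ∈-edgeList x<y e
  ... | no  x≮y = ∈-edgeList (≤∧≢⇒<ᶠ (≮⇒≥ x≮y) (Adj⇒≢ G e ∘ sym)) (Adj-sym G e)

  ordered-∈-edgeList⁻ : ∀ {x y} → ordered x y ∈ₗ edgeList G → Adj G x y
  ordered-∈-edgeList⁻ {x} {y} e∈ with x <? y
  ... | yes _ = ∈-edgeList⁻ e∈
  ... | no  _ = Adj-sym G (∈-edgeList⁻ e∈)

module _ (G : Graph (suc n)) where

  Reach : ℕ → Fin (suc n) → Set
  Reach zero    x = x ≡ zero
  Reach (suc l) x = ∃ λ w → Adj G x w × Reach l w

  reach? : ∀ l x → Dec (Reach l x)
  reach? zero    x = x ≟ᶠ zero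
  reach? (suc l) x = any? (λ w → T? (adj G x w) ×-dec reach? l w)

  walk⇒Reach : ∀ {X x} → WalkIn G X x zero → ∃ λ l → Reach l x
  walk⇒Reach (here _)     = zero , refl
  walk⇒Reach (step _ e w) = suc (proj₁ (walk⇒Reach w)) , _ , e , proj₂ (walk⇒Reach w)

module _ (G : Graph (suc n)) (conn : Connected G) where

  nearest : ∀ x → ∃ λ l → Reach G l x × (∀ {j} → Reach G j x → l ≤ j)
  nearest x = least-witness (λ l → reach? G l x) (proj₂ (walk⇒Reach G (conn x zero)))

  distance : Fin (suc n) → ℕ
  distance x = proj₁ (nearest x)

  parent : (i : Fin n) → ∃ λ w → Adj G (suc i) w × distance w < distance (suc i)
  parent i with nearest (suc i)
  ... | zero  , ()            , _
  ... | suc l , (w , e , r) , _ = w , e , s≤s (proj₂ (proj₂ (nearest w)) r)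

  parentEdge : Fin n → Fin (length (edgeList G))
  parentEdge i = index (ordered-∈-edgeList G (proj₁ (proj₂ (parent i))))

  parentEdge-injective : ∀ {i j} → parentEdge i ≡ parentEdge j → i ≡ j
  parentEdge-injective {i} {j} eq with ordered-injective same-pair
    where
    same-pair : ordered (suc i) (proj₁ (parent i)) ≡ ordered (suc j) (proj₁ (parent j))
    same-pair = trans (lookup-index (ordered-∈-edgeList G (proj₁ (proj₂ (parent i)))))
                  (trans (cong (lookup (edgeList G)) eq)
                    (sym (lookup-index (ordered-∈-edgeList G (proj₁ (proj₂ (parent j)))))))
  ... | inj₁ (refl , _) = refl
  ... | inj₂ (i≡pj , pi≡j) = contradiction (<-trans closer-i closer-j) (<-irrefl refl)
    where
    closer-i : distance (suc j) < distance (suc i)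
    closer-i = subst (λ v → distance v < distance (suc i)) pi≡j (proj₂ (proj₂ (parent i)))
    closer-j : distance (suc i) < distance (suc j)
    closer-j = subst (λ v → distance v < distance (suc j)) (sym i≡pj) (proj₂ (proj₂ (parent j)))

connected⇒n∸1≤numEdges : (G : Graph n) → Connected G → n ∸ 1 ≤ numEdges G
connected⇒n∸1≤numEdges {zero}  G conn = z≤n
connected⇒n∸1≤numEdges {suc n} G conn = injective⇒≤ (parentEdge-injective G conn)

Joins : Fin n → Fin n → Fin n → Fin n → Set
Joins a b x y = (x ≡ a × y ≡ b) ⊎ (x ≡ b × y ≡ a)

joins? : (a b x y : Fin n) → Dec (Joins a b x y)
joins? a b x y = ((x ≟ᶠ a) ×-dec (y ≟ᶠ b)) ⊎-dec ((x ≟ᶠ b) ×-dec (y ≟ᶠ a))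

removeEdge : Graph n → Fin n → Fin n → Graph n
removeEdge G a b = record
  { adj    = λ x y → adj G x y ∧ not (does (joins? a b x y))
  ; sym    = λ x y → cong₂ (λ e j → e ∧ not j) (Graph.sym G x y) (joins-sym x y)
  ; irrefl = λ x → cong (_∧ _) (Graph.irrefl G x)
  }
  where
  joins-sym : ∀ x y → does (joins? a b x y) ≡ does (joins? a b y x)
  joins-sym x y =
    trans (∨-comm (does (x ≟ᶠ a) ∧ does (y ≟ᶠ b)) (does (x ≟ᶠ b) ∧ does (y ≟ᶠ a)))
      (cong₂ _∨_ (∧-comm (does (x ≟ᶠ b)) (does (y ≟ᶠ a))) (∧-comm (does (x ≟ᶠ a)) (does (y ≟ᶠ b))))

module _ (G : Graph n) (a b : Fin n) where

  removeEdge⇒Adj : ∀ {x y} → Adj (removeEdge G a b) x y → Adj G x y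
  removeEdge⇒Adj = proj₁ ∘ Equivalence.to T-∧

  Adj⇒removeEdge : ∀ {x y} → Adj G x y → ¬ Joins a b x y → Adj (removeEdge G a b) x y
  Adj⇒removeEdge {x} {y} e ¬joins =
    Equivalence.from T-∧ (e , subst (T ∘ not) (sym (dec-false (joins? a b x y) ¬joins)) tt)

  removeEdge-removes : ¬ Adj (removeEdge G a b) a b
  removeEdge-removes e =
    subst (T ∘ not) (dec-true (joins? a b a b) (inj₁ (refl , refl))) (proj₂ (Equivalence.to T-∧ e))

numEdges-removeEdge< : (G : Graph n) {a b : Fin n} → Adj G a b → numEdges (removeEdge G a b) < numEdges G
numEdges-removeEdge< G {a} {b} e =
  length-mono-< fewer (ordered-∈-edgeList G e)
    (removeEdge-removes G a b ∘ ordered-∈-edgeList⁻ (removeEdge G a b))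
  where
  fewer : edgeList (removeEdge G a b) ⊆ₗ edgeList G
  fewer = filter⁺ (isEdge? (removeEdge G a b)) (isEdge? G)
            (λ { refl → Equivalence.to T-≡ ∘ removeEdge⇒Adj G a b ∘ Equivalence.from T-≡ })
            (⊆-refl {x = orderedPairs _})

-- If p ≢ q, deleting the edge bp leaves G connected (b reaches p through q and S) with
-- fewer than n − 1 edges.
tree⇒unique-neighbour : {G : Graph n} → IsTree G → ∀ {S b p q} → InducedConnected G S →
  b ∉ S → p ∈ S → q ∈ S → Adj G b p → Adj G b q → p ≡ q
tree⇒unique-neighbour {G = G} (conn , size) {S} {b} {p} {q} connS b∉S p∈S q∈S bp bq with p ≟ᶠ q
... | yes p≡q = p≡q
... | no  p≢q = contradiction (connected⇒n∸1≤numEdges G′ conn′)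
                  (<⇒≱ (subst (numEdges G′ <_) size (numEdges-removeEdge< G bp)))
  where
  G′ : Graph _
  G′ = removeEdge G b p

  within-S : ∀ {x y} → x ∈ S → y ∈ S → WalkIn G′ ⊤ x y
  within-S x∈ y∈ = reroute (λ x∈ y∈ e → edgeʷ ∈⊤ ∈⊤ (Adj⇒removeEdge G b p e (avoids x∈ y∈))) (λ _ → ∈⊤)
                     (connS _ _ x∈ y∈)
    where
    avoids : ∀ {x y} → x ∈ S → y ∈ S → ¬ Joins b p x y
    avoids x∈ _  (inj₁ (refl , _)) = b∉S x∈
    avoids _  y∈ (inj₂ (_ , refl)) = b∉S y∈

  via-q : WalkIn G′ ⊤ b p
  via-q = step ∈⊤ (Adj⇒removeEdge G b p bq λ { (inj₁ (_ , q≡p)) → p≢q (sym q≡p)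
                                               ; (inj₂ (b≡p , _)) → Adj⇒≢ G bp b≡p })
            (within-S q∈S p∈S)

  bypass : ∀ {x y} → x ∈ ⊤ → y ∈ ⊤ → Adj G x y → WalkIn G′ ⊤ x y
  bypass {x} {y} _ _ e with joins? b p x y
  ... | no ¬joins                = edgeʷ ∈⊤ ∈⊤ (Adj⇒removeEdge G b p e ¬joins)
  ... | yes (inj₁ (refl , refl)) = via-q
  ... | yes (inj₂ (refl , refl)) = reverseʷ via-q

  conn′ : Connected G′
  conn′ x y = reroute bypass (λ x∈ → x∈) (conn x y)

-- Trees and their connected k-sets

SameConnectedKSets-sym : ∀ {k} {G H : Graph n} → SameConnectedKSets k G H → SameConnectedKSets k H G
SameConnectedKSets-sym same X = ⇔-sym (same X)

∣⁅x⁆∪⁅y⁆∣≡2 : {x y : Fin n} → x ≢ y → ∣ ⁅ x ⁆ ∪ ⁅ y ⁆ ∣ ≡ 2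
∣⁅x⁆∪⁅y⁆∣≡2 {x = x} x≢y = trans (∣p∪⁅x⁆∣≡1+∣p∣ (x≢y ∘ sym ∘ x∈⁅y⁆⇒x≡y x)) (cong suc (∣⁅x⁆∣≡1 x))

module _ (G : Graph n) where

  Adj⇒ConnectedKSet₂ : ∀ {x y} → Adj G x y → ConnectedKSet 2 G (⁅ x ⁆ ∪ ⁅ y ⁆)
  Adj⇒ConnectedKSet₂ {x} e = ∣⁅x⁆∪⁅y⁆∣≡2 (Adj⇒≢ G e) , ∪⁅⁆-connected G (⁅x⁆-connected G x) (x∈⁅x⁆ x) e

  ConnectedKSet₂⇒Adj : ∀ {x y} → x ≢ y → ConnectedKSet 2 G (⁅ x ⁆ ∪ ⁅ y ⁆) → Adj G x y
  ConnectedKSet₂⇒Adj {x} {y} x≢y (_ , conn) with conn x y (p⊆p∪⁅x⁆ (x∈⁅x⁆ x)) (x∈p∪⁅x⁆ y)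
  ... | here _ = contradiction refl x≢y
  ... | step _ e w with x∈p∪⁅y⁆⁻ (walk-head w)
  ...   | inj₂ refl = e
  ...   | inj₁ x′∈⁅x⁆ with x∈⁅y⁆⇒x≡y x x′∈⁅x⁆
  ...     | refl = contradiction refl (Adj⇒≢ G e)

SameConnectedKSets₂⇒SameEdges : {G H : Graph n} → SameConnectedKSets 2 G H → SameEdges G H
SameConnectedKSets₂⇒SameEdges same x y =
  T-injective (mk⇔ (transfer same) (transfer (SameConnectedKSets-sym same)))
  where
  transfer : ∀ {G H} → SameConnectedKSets 2 G H → Adj G x y → Adj H x y
  transfer {G} {H} same e =
    ConnectedKSet₂⇒Adj H (Adj⇒≢ G e) (Equivalence.to (same _) (Adj⇒ConnectedKSet₂ G e))

module Descent {T₁ T₂ : Graph n} (tree₁ : IsTree T₁) (tree₂ : IsTree T₂) {j : ℕ}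
  (fits : (2 + j) + (1 + j) ≤ n) (same : SameConnectedKSets (2 + j) T₁ T₂) where

  in-T₁ : ∀ {X} → InducedConnected T₂ X → ∣ X ∣ ≡ 2 + j → InducedConnected T₁ X
  in-T₁ {X} conn size = proj₂ (Equivalence.from (same X) (size , conn))

  in-T₂ : ∀ {X} → InducedConnected T₁ X → ∣ X ∣ ≡ 2 + j → InducedConnected T₂ X
  in-T₂ {X} conn size = proj₂ (Equivalence.to (same X) (size , conn))

  module Pendant {Y : Subset n} (size : ∣ Y ∣ ≡ 1 + j) (conn : InducedConnected T₁ Y)
    {y₁ a : Fin n} (y₁∈Y : y₁ ∈ Y) (a∉Y : a ∉ Y) (y₁a : Adj T₁ y₁ a) where

    extend : ∀ {y b} → y ∈ Y → b ∉ Y → Adj T₁ y b → InducedConnected T₂ (Y ∪ ⁅ b ⁆)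
    extend y∈Y b∉Y yb = in-T₂ (∪⁅⁆-connected T₁ conn y∈Y yb) (trans (∣p∪⁅x⁆∣≡1+∣p∣ b∉Y) (cong suc size))

    module TwoNeighbours {p q : Fin n} (p∈Y : p ∈ Y) (q∈Y : q ∈ Y) (p≢q : p ≢ q)
      (ap : Adj T₂ a p) (aq : Adj T₂ a q) where

      exit-is-a : ∀ {y b} → y ∈ Y → b ∉ Y → Adj T₁ y b → b ≡ a
      exit-is-a {y} {b} y∈Y b∉Y yb with b ≟ᶠ a
      ... | yes b≡a = b≡a
      ... | no  b≢a = contradiction
        (tree⇒unique-neighbour tree₂ (extend y∈Y b∉Y yb) a∉Y∪b (p⊆p∪⁅x⁆ p∈Y) (p⊆p∪⁅x⁆ q∈Y) ap aq) p≢q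
        where
        a∉Y∪b : a ∉ Y ∪ ⁅ b ⁆
        a∉Y∪b a∈ with x∈p∪⁅y⁆⁻ a∈
        ... | inj₁ a∈Y = a∉Y a∈Y
        ... | inj₂ a≡b = b≢a (sym a≡b)

      entry-is-y₁ : ∀ {y} → y ∈ Y → Adj T₁ y a → y ≡ y₁
      entry-is-y₁ y∈Y ya = tree⇒unique-neighbour tree₁ conn a∉Y y∈Y y₁∈Y (Adj-sym T₁ ya) (Adj-sym T₁ y₁a)

      straddling : ∀ {X c z} → InducedConnected T₁ X → c ∈ X → c ∈ Y → z ∈ X → z ∉ Y → a ∈ X × y₁ ∈ X
      straddling connX c∈X c∈Y z∈X z∉Y with crossing-edge T₁ (connX _ _ c∈X z∈X) c∈Y z∉Y
      ... | x , x′ , x∈Y , x′∉Y , xx′ , x∈X , x′∈X with exit-is-a x∈Y x′∉Y xx′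
      ...   | refl = x′∈X , subst (_∈ _) (entry-is-y₁ x∈Y xx′) x∈X

      other-neighbour : ∃ λ c → c ∈ Y × Adj T₂ a c × c ≢ y₁
      other-neighbour with p ≟ᶠ y₁
      ... | yes refl = q , q∈Y , aq , p≢q ∘ sym
      ... | no  p≢y₁ = p , p∈Y , ap , p≢y₁

      no-large-set-avoiding-y₁ : ∀ {X c} → InducedConnected T₂ X → ∣ X ∣ ≡ 2 + j →
        a ∈ X → c ∈ X → c ∈ Y → y₁ ∉ X → ⊥
      no-large-set-avoiding-y₁ connX sizeX a∈X c∈X c∈Y y₁∉X =
        y₁∉X (proj₂ (straddling (in-T₁ connX sizeX) c∈X c∈Y a∈X a∉Y))

      no-large-set-avoiding-a : ∀ {X} → InducedConnected T₂ X → ∣ X ∣ ≡ 2 + j → y₁ ∈ X → a ∉ X → ⊥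
      no-large-set-avoiding-a {X} connX sizeX y₁∈X a∉X with ⊆-or-∃∉ X Y
      ... | inj₁ X⊆Y = contradiction (subst₂ _≤_ sizeX size (p⊆q⇒∣p∣≤∣q∣ X⊆Y)) (<-irrefl refl)
      ... | inj₂ (z , z∈X , z∉Y) = a∉X (proj₁ (straddling (in-T₁ connX sizeX) y₁∈X y₁∈Y z∈X z∉Y))

      no-small-branch-at-y₁ : ∀ {C} → ClosedIn T₂ (∁ ⁅ y₁ ⁆) C → C ⊆ ∁ ⁅ y₁ ⁆ → a ∈ C → ∣ C ∣ ≤ 1 + j → ⊥
      no-small-branch-at-y₁ {C} closed C⊆ a∈C small
        with connected-subset-of-size T₂ (∁-connected T₂ (proj₁ tree₂) closed a∈C) (⁅x⁆-connected T₂ y₁)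
               y₁⊆∁C (x∈⁅x⁆ y₁) (1 + j) room
        where
        y₁⊆∁C : ⁅ y₁ ⁆ ⊆ ∁ C
        y₁⊆∁C y∈ with x∈⁅y⁆⇒x≡y y₁ y∈
        ... | refl = x∉p⇒x∈∁p λ y₁∈C → x∈∁p⇒x∉p (C⊆ y₁∈C) (x∈⁅x⁆ y₁)
        room : (1 + j) + ∣ ⁅ y₁ ⁆ ∣ ≤ ∣ ∁ C ∣
        room = subst₂ _≤_ (trans (+-comm 1 (1 + j)) (cong ((1 + j) +_) (sym (∣⁅x⁆∣≡1 y₁))))
                 (sym (∣∁p∣≡n∸∣p∣ C)) (m+n≤o⇒m≤o∸n (2 + j) (≤-trans (+-monoʳ-≤ (2 + j) small) fits))
      ... | X , connX , y₁⊆X , X⊆∁C , sizeX =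
        no-large-set-avoiding-a connX
          (trans sizeX (trans (cong ((1 + j) +_) (∣⁅x⁆∣≡1 y₁)) (+-comm (1 + j) 1))) (y₁⊆X (x∈⁅x⁆ y₁))
          (λ a∈X → x∈∁p⇒x∉p (X⊆∁C a∈X) a∈C)

      module _ {c : Fin n} (c∈Y : c ∈ Y) (ac : Adj T₂ a c) (c≢y₁ : c ≢ y₁) where

        ∣a,c∣≡2 : ∣ ⁅ a ⁆ ∪ ⁅ c ⁆ ∣ ≡ 2
        ∣a,c∣≡2 = ∣⁅x⁆∪⁅y⁆∣≡2 λ a≡c → a∉Y (subst (_∈ Y) (sym a≡c) c∈Y)

        a,c⊆∁y₁ : ⁅ a ⁆ ∪ ⁅ c ⁆ ⊆ ∁ ⁅ y₁ ⁆
        a,c⊆∁y₁ x∈ with x∈p∪⁅y⁆⁻ x∈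
        ... | inj₂ refl = x∉p⇒x∈∁p (x≢y⇒x∉⁅y⁆ c≢y₁)
        ... | inj₁ x∈⁅a⁆ with x∈⁅y⁆⇒x≡y a x∈⁅a⁆
        ...   | refl = x∉p⇒x∈∁p (x≢y⇒x∉⁅y⁆ λ a≡y₁ → a∉Y (subst (_∈ Y) (sym a≡y₁) y₁∈Y))

        resolve : Growth T₂ (∁ ⁅ y₁ ⁆) (⁅ a ⁆ ∪ ⁅ c ⁆) (j + ∣ ⁅ a ⁆ ∪ ⁅ c ⁆ ∣) → ⊥
        resolve (reached X connX a,c⊆X X⊆ sizeX) =
          no-large-set-avoiding-y₁ connX (trans sizeX (trans (cong (j +_) ∣a,c∣≡2) (+-comm j 2)))
            (a,c⊆X (p⊆p∪⁅x⁆ (x∈⁅x⁆ a))) (a,c⊆X (x∈p∪⁅x⁆ c)) c∈Y (λ y₁∈X → x∈∁p⇒x∉p (X⊆ y₁∈X) (x∈⁅x⁆ y₁))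
        resolve (stuck C _ a,c⊆C C⊆ sizeC closed) =
          no-small-branch-at-y₁ closed C⊆ (a,c⊆C (p⊆p∪⁅x⁆ (x∈⁅x⁆ a)))
            (≤-pred (subst (∣ C ∣ <_) (trans (cong (j +_) ∣a,c∣≡2) (+-comm j 2)) sizeC))

        growth-absurd : ⊥
        growth-absurd = resolve (grow T₂ j (∪⁅⁆-connected T₂ (⁅x⁆-connected T₂ a) (x∈⁅x⁆ a) ac) a,c⊆∁y₁)

      absurd : ⊥
      absurd = let c , c∈Y , ac , c≢y₁ = other-neighbour in growth-absurd c∈Y ac c≢y₁

  transfer : ∀ {Y} → ConnectedKSet (1 + j) T₁ Y → InducedConnected T₂ Y
  transfer {Y} (size , conn) with nonempty? Y
  ... | no empty = λ x _ x∈Y _ → contradiction (x , x∈Y) empty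
  ... | yes (y₀ , y₀∈Y) with ⊆-or-∃∉ ⊤ Y
  ...   | inj₁ ⊤⊆Y = contradiction (subst₂ _≤_ (∣⊤∣≡n n) size (p⊆q⇒∣p∣≤∣q∣ ⊤⊆Y))
                       (<⇒≱ (≤-trans (m≤m+n (2 + j) (1 + j)) fits))
  ...   | inj₂ (o , _ , o∉Y) with crossing-edge T₁ (proj₁ tree₁ y₀ o) y₀∈Y o∉Y
  ...     | y₁ , a , y₁∈Y , a∉Y , y₁a , _ = ∪⁅⁆-connected⁻ T₂ a∉Y unique (extend y₁∈Y a∉Y y₁a)
    where
    open Pendant size conn y₁∈Y a∉Y y₁a
    unique : ∀ {p q} → p ∈ Y → q ∈ Y → Adj T₂ a p → Adj T₂ a q → p ≡ q
    unique {p} {q} p∈Y q∈Y ap aq with p ≟ᶠ q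
    ... | yes p≡q = p≡q
    ... | no  p≢q = ⊥-elim (TwoNeighbours.absurd p∈Y q∈Y p≢q ap aq)

SameConnectedKSets-descend : {T₁ T₂ : Graph n} → IsTree T₁ → IsTree T₂ → ∀ {j} → (2 + j) + (1 + j) ≤ n →
  SameConnectedKSets (2 + j) T₁ T₂ → SameConnectedKSets (1 + j) T₁ T₂
SameConnectedKSets-descend tree₁ tree₂ fits same X = mk⇔
  (λ ck → proj₁ ck , Descent.transfer tree₁ tree₂ fits same ck)
  (λ ck → proj₁ ck , Descent.transfer tree₂ tree₁ fits (SameConnectedKSets-sym same) ck)

SameConnectedKSets⇒SameConnectedKSets₂ : {T₁ T₂ : Graph n} → IsTree T₁ → IsTree T₂ →
  ∀ k → 2 ≤ k → k + k ≤ suc n → SameConnectedKSets k T₁ T₂ → SameConnectedKSets 2 T₁ T₂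
SameConnectedKSets⇒SameConnectedKSets₂ tree₁ tree₂ (suc zero) (s≤s ()) _ _
SameConnectedKSets⇒SameConnectedKSets₂ tree₁ tree₂ (suc (suc zero)) _ _ same = same
SameConnectedKSets⇒SameConnectedKSets₂ {n} tree₁ tree₂ (suc (suc (suc j))) _ fits same =
  SameConnectedKSets⇒SameConnectedKSets₂ tree₁ tree₂ (suc (suc j)) (s≤s (s≤s z≤n))
    (≤-trans (+-mono-≤ (n≤1+n (2 + j)) (n≤1+n (2 + j))) fits)
    (SameConnectedKSets-descend tree₁ tree₂ (≤-pred (subst (_≤ suc n) (+-suc (3 + j) (2 + j)) fits)) same)

SameConnectedKSets⇒SameEdges : {T₁ T₂ : Graph n} → IsTree T₁ → IsTree T₂ →
  ∀ {k} → 2 ≤ k → k + k ≤ suc n → SameConnectedKSets k T₁ T₂ → SameEdges T₁ T₂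
SameConnectedKSets⇒SameEdges tree₁ tree₂ {k} 2≤k fits =
  SameConnectedKSets₂⇒SameEdges ∘ SameConnectedKSets⇒SameConnectedKSets₂ tree₁ tree₂ k 2≤k fits

-- Paths and their connected k-sets

Consecutive-irrefl : ∀ {i} → ¬ Consecutive i i
Consecutive-irrefl (inj₁ e) = 1+n≢n e
Consecutive-irrefl (inj₂ e) = 1+n≢n e

consecutive? : (i j : ℕ) → Dec (Consecutive i j)
consecutive? i j = (suc i ≟ j) ⊎-dec (suc j ≟ i)

pathGraph : (Fin n → ℕ) → Graph n
pathGraph pos = record
  { adj    = λ x y → isYes (consecutive? (pos x) (pos y))
  ; sym    = λ x y → trans (isYes≗does (consecutive? (pos x) (pos y)))
                       (trans (∨-comm (does (suc (pos x) ≟ pos y)) (does (suc (pos y) ≟ pos x)))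
                         (sym (isYes≗does (consecutive? (pos y) (pos x)))))
  ; irrefl = λ x → trans (isYes≗does (consecutive? (pos x) (pos x)))
                       (dec-false (consecutive? (pos x) (pos x)) Consecutive-irrefl)
  }

module _ (pos : Fin n → ℕ) {x y : Fin n} where

  Adj⇒Consecutive : Adj (pathGraph pos) x y → Consecutive (pos x) (pos y)
  Adj⇒Consecutive = toWitness

  Consecutive⇒Adj : Consecutive (pos x) (pos y) → Adj (pathGraph pos) x y
  Consecutive⇒Adj = fromWitness

pathGraph-cong : {pos pos′ : Fin n → ℕ} → (∀ x → pos x ≡ pos′ x) → SameEdges (pathGraph pos) (pathGraph pos′)
pathGraph-cong eq x y = cong₂ (λ i j → isYes (consecutive? i j)) (eq x) (eq y)

position : Permutation′ n → Fin n → ℕ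
position π x = toℕ (π ⟨$⟩ʳ x)

position-⟨$⟩ˡ : (π : Permutation′ n) (i : Fin n) → position π (π ⟨$⟩ˡ i) ≡ toℕ i
position-⟨$⟩ˡ π i = cong toℕ (inverseʳ π)

pathGraph-isPath : (π : Permutation′ n) → IsPath (pathGraph (position π))
pathGraph-isPath π = ↔⇒⤖ (flip π) , λ i j → mk⇔
  (λ e → subst₂ Consecutive (position-⟨$⟩ˡ π i) (position-⟨$⟩ˡ π j) (Adj⇒Consecutive (position π) e))
  (λ c → Consecutive⇒Adj (position π) (subst₂ Consecutive (sym (position-⟨$⟩ˡ π i)) (sym (position-⟨$⟩ˡ π j)) c))

IsPath⇒pathGraph : (P : Graph n) ((σ , _) : IsPath P) → SameEdges P (pathGraph (position (flip (⤖⇒↔ σ))))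
IsPath⇒pathGraph P (σ , adj⇔) x y = T-injective (mk⇔
  (λ e → Consecutive⇒Adj (position π) (Equivalence.to (adj⇔ (π ⟨$⟩ʳ x) (π ⟨$⟩ʳ y))
           (subst₂ (Adj P) (sym (inverseˡ π)) (sym (inverseˡ π)) e)))
  (λ e → subst₂ (Adj P) (inverseˡ π) (inverseˡ π)
           (Equivalence.from (adj⇔ (π ⟨$⟩ʳ x) (π ⟨$⟩ʳ y)) (Adj⇒Consecutive (position π) e))))
  where
  π : Permutation′ _
  π = flip (⤖⇒↔ σ)

swapℕ : ℕ → ℕ → ℕ
swapℕ m i with i ≟ m
... | yes _ = suc m
... | no  _ with i ≟ suc m
...   | yes _ = m
...   | no  _ = i

swapℕ-left : ∀ m → swapℕ m m ≡ suc m
swapℕ-left m with m ≟ m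
... | yes _   = refl
... | no  m≢m = contradiction refl m≢m

swapℕ-right : ∀ m → swapℕ m (suc m) ≡ m
swapℕ-right m with suc m ≟ m
... | yes 1+m≡m = contradiction 1+m≡m 1+n≢n
... | no  _ with suc m ≟ suc m
...   | yes _     = refl
...   | no  m≢m = contradiction refl m≢m

swapℕ-other : ∀ {m i} → i ≢ m → i ≢ suc m → swapℕ m i ≡ i
swapℕ-other {m} {i} i≢m i≢1+m with i ≟ m
... | yes i≡m = contradiction i≡m i≢m
... | no  _ with i ≟ suc m
...   | yes i≡1+m = contradiction i≡1+m i≢1+m
...   | no  _     = refl

swapℕ-2+ : ∀ m → swapℕ m (2 + m) ≡ 2 + m
swapℕ-2+ m = swapℕ-other (>⇒≢ (m<n⇒m<1+n (n<1+n m))) (>⇒≢ (n<1+n (suc m)))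

swapℕ-involutive : ∀ m i → swapℕ m (swapℕ m i) ≡ i
swapℕ-involutive m i with i ≟ m
... | yes refl = swapℕ-right i
... | no  i≢m with i ≟ suc m
...   | yes refl = swapℕ-left m
...   | no  i≢1+m = swapℕ-other i≢m i≢1+m

toℕ-transpose : {p q : Fin n} {m : ℕ} → toℕ p ≡ m → toℕ q ≡ suc m →
  ∀ i → toℕ (transpose p q ⟨$⟩ʳ i) ≡ swapℕ m (toℕ i)
toℕ-transpose {p = p} {q} {m} p↦m q↦1+m i with i ≟ᶠ p
... | yes refl = trans q↦1+m (sym (trans (cong (swapℕ m) p↦m) (swapℕ-left m)))
... | no  i≢p with i ≟ᶠ q
...   | yes refl = trans p↦m (sym (trans (cong (swapℕ m) q↦1+m) (swapℕ-right m)))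
...   | no  i≢q = sym (swapℕ-other (λ i↦m → i≢p (toℕ-injective (trans i↦m (sym p↦m))))
                                   (λ i↦1+m → i≢q (toℕ-injective (trans i↦1+m (sym q↦1+m)))))

data Detour (m a b : ℕ) : Set where
  direct : Consecutive (swapℕ m a) (swapℕ m b) → Detour m a b
  via    : ∀ h → h ≡ m ⊎ h ≡ suc m → Consecutive (swapℕ m a) h → Consecutive h (swapℕ m b) → Detour m a b

Detour-sym : ∀ {m a b} → Detour m a b → Detour m b a
Detour-sym (direct c)      = direct (swapᵤ c)
Detour-sym (via h h∈ c c′) = via h h∈ (swapᵤ c′) (swapᵤ c)

detour-successor : ∀ m a → Detour m a (suc a)
detour-successor m a with a ≟ m | a ≟ suc m | suc a ≟ m
... | yes refl | _ | _ = direct (subst₂ Consecutive (sym (swapℕ-left a)) (sym (swapℕ-right a)) (inj₂ refl))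
... | no _ | yes refl | _ =
  via (suc m) (inj₂ refl) (subst (λ i → Consecutive i (suc m)) (sym (swapℕ-right m)) (inj₁ refl))
    (subst (Consecutive (suc m)) (sym (swapℕ-2+ m)) (inj₁ refl))
... | no a≢m | no a≢1+m | yes refl =
  via (suc a) (inj₁ refl) (subst (λ i → Consecutive i (suc a)) (sym (swapℕ-other a≢m a≢1+m)) (inj₁ refl))
    (subst (Consecutive (suc a)) (sym (swapℕ-left (suc a))) (inj₁ refl))
... | no a≢m | no a≢1+m | no 1+a≢m =
  direct (subst₂ Consecutive (sym (swapℕ-other a≢m a≢1+m)) (sym (swapℕ-other 1+a≢m (a≢m ∘ suc-injective)))
    (inj₁ refl))

detour : ∀ m {a b} → Consecutive a b → Detour m a b
detour m (inj₁ refl) = detour-successor m _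
detour m (inj₂ refl) = Detour-sym (detour-successor m _)

walk-intermediate : (pos : Fin n → ℕ) {X : Subset n} {x y : Fin n} (t : ℕ) →
  WalkIn (pathGraph pos) X x y → pos x ≤ t → t ≤ pos y → ∃ λ v → v ∈ X × pos v ≡ t
walk-intermediate pos t (here x∈) x≤t t≤x = _ , x∈ , ≤-antisym x≤t t≤x
walk-intermediate pos t (step {x = x} {y = x′} x∈ e w) x≤t t≤y with pos x ≟ t
... | yes x↦t = x , x∈ , x↦t
... | no  x↦̸t = walk-intermediate pos t w x′≤t t≤y
  where
  x′≤t : pos x′ ≤ t
  x′≤t with Adj⇒Consecutive pos e
  ... | inj₁ 1+x≡x′ = subst (_≤ t) 1+x≡x′ (≤∧≢⇒< x≤t x↦̸t)
  ... | inj₂ 1+x′≡x = ≤-trans (n≤1+n (pos x′)) (subst (_≤ t) (sym 1+x′≡x) x≤t)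

module _ (π : Permutation′ n) where

  position↦⇒≡ : ∀ {x i} → position π x ≡ toℕ i → x ≡ π ⟨$⟩ˡ i
  position↦⇒≡ x↦i = trans (sym (inverseˡ π)) (cong (π ⟨$⟩ˡ_) (toℕ-injective x↦i))

  position-injective : ∀ {x y} → position π x ≡ position π y → x ≡ y
  position-injective x↦y = trans (position↦⇒≡ x↦y) (inverseˡ π)

  -- A connected set avoiding position i lies on one side of it, where fewer than k positions fit.
  ConnectedKSet-covers : ∀ {k X} → ConnectedKSet k (pathGraph (position π)) X →
    (i : Fin n) → toℕ i < k → n ≤ toℕ i + k → π ⟨$⟩ˡ i ∈ X
  ConnectedKSet-covers {k} {X} (size , conn) i i<k n≤i+k =
    decidable-stable (π ⟨$⟩ˡ i ∈? X) λ v∉X → gap-absurd (λ x∈ x↦i → v∉X (subst (_∈ X) (position↦⇒≡ x↦i) x∈))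
    where
    t = toℕ i
    counted : ∀ {lo hi} → (∀ {x} → x ∈ X → lo ≤ position π x × position π x < hi) → k ≤ hi ∸ lo
    counted bounds = subst (_≤ _) size
      (∣p∣≤-of-injective-into-interval X (position π) (λ _ _ → position-injective) bounds)
    gap-absurd : (∀ {x} → x ∈ X → position π x ≢ t) → ⊥
    gap-absurd gap with any? (λ x → (x ∈? X) ×-dec (position π x <ℕ? t))
                      | any? (λ y → (y ∈? X) ×-dec (t <ℕ? position π y))
    ... | yes (x , x∈ , x<t) | yes (y , y∈ , t<y) =
      let v , v∈ , v↦t = walk-intermediate (position π) t (conn x y x∈ y∈) (<⇒≤ x<t) (<⇒≤ t<y) in gap v∈ v↦t
    ... | _ | no none-above =
      <⇒≱ i<k (counted λ x∈ → z≤n , ≤∧≢⇒< (≮⇒≥ (λ t<x → none-above (_ , x∈ , t<x))) (gap x∈))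
    ... | no none-below | _ = <-irrefl refl (≤-trans squeezed n≤i+k)
      where
      squeezed : suc (t + k) ≤ n
      squeezed = subst (_≤ n) (trans (+-suc k t) (cong suc (+-comm k t)))
        (m≤o∸n⇒m+n≤o k (toℕ<n i) (counted λ {x} x∈ →
          ≤∧≢⇒< (≮⇒≥ (λ x<t → none-below (_ , x∈ , x<t))) (gap x∈ ∘ sym) , toℕ<n (π ⟨$⟩ʳ x)))

module SwapAdjacent (π : Permutation′ n) {m k : ℕ} (m+k≡n : m + k ≡ n) (2+m≤k : 2 + m ≤ k) where

  Q Q′ : Graph n
  Q  = pathGraph (position π)
  Q′ = pathGraph (swapℕ m ∘ position π)

  k≤n : k ≤ n
  k≤n = subst (k ≤_) m+k≡n (m≤n+m k m)

  vertexAt : ∀ t → t < k → Fin n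
  vertexAt t t<k = π ⟨$⟩ˡ fromℕ< (<-≤-trans t<k k≤n)

  position-vertexAt : ∀ t (t<k : t < k) → position π (vertexAt t t<k) ≡ t
  position-vertexAt t t<k = trans (position-⟨$⟩ˡ π _) (toℕ-fromℕ< _)

  vertexAt-∈ : ∀ {X} → ConnectedKSet k Q X → ∀ t (t<k : t < k) → n ≤ t + k → vertexAt t t<k ∈ X
  vertexAt-∈ ck t t<k n≤t+k = ConnectedKSet-covers π ck _
    (subst (_< k) (sym (toℕ-fromℕ< _)) t<k) (subst (λ t → n ≤ t + k) (sym (toℕ-fromℕ< _)) n≤t+k)

  m<k : m < k
  m<k = ≤-trans (n≤1+n (suc m)) 2+m≤k

  u w : Fin n
  u = vertexAt m m<k
  w = vertexAt (suc m) 2+m≤k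

  n≤m+k : n ≤ m + k
  n≤m+k = ≤-reflexive (sym m+k≡n)

  hub : ∀ {X h} → ConnectedKSet k Q X → h ≡ m ⊎ h ≡ suc m → ∃ λ v → v ∈ X × swapℕ m (position π v) ≡ h
  hub ck (inj₁ refl) = w , vertexAt-∈ ck (suc m) 2+m≤k (≤-trans n≤m+k (n≤1+n _)) ,
                       trans (cong (swapℕ m) (position-vertexAt (suc m) 2+m≤k)) (swapℕ-right m)
  hub ck (inj₂ refl) = u , vertexAt-∈ ck m m<k n≤m+k ,
                       trans (cong (swapℕ m) (position-vertexAt m m<k)) (swapℕ-left m)

  rerouted : ∀ {X} → ConnectedKSet k Q X → ∀ {x y} → x ∈ X → y ∈ X → Adj Q x y → WalkIn Q′ X x y
  rerouted ck x∈ y∈ e with detour m (Adj⇒Consecutive (position π) e)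
  ... | direct c = edgeʷ x∈ y∈ (Consecutive⇒Adj (swapℕ m ∘ position π) c)
  ... | via h h∈ c c′ = let v , v∈ , v↦h = hub ck h∈ in
    step x∈ (Consecutive⇒Adj (swapℕ m ∘ position π) (subst (Consecutive _) (sym v↦h) c))
      (edgeʷ v∈ y∈ (Consecutive⇒Adj (swapℕ m ∘ position π) (subst (λ i → Consecutive i _) (sym v↦h) c′)))

  ConnectedKSet-swap : ∀ {X} → ConnectedKSet k Q X → ConnectedKSet k Q′ X
  ConnectedKSet-swap ck = proj₁ ck , reroute-connected (rerouted ck) (proj₂ ck)

Consecutive-skip : ∀ m → ¬ Consecutive m (2 + m)
Consecutive-skip m (inj₁ 1+m≡2+m) = 1+n≢n (sym (suc-injective 1+m≡2+m))
Consecutive-skip m (inj₂ 3+m≡m)   = >⇒≢ (m<n⇒m<1+n (m<n⇒m<1+n (n<1+n m))) 3+m≡m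

IsPath⇒swapped-path : (P : Graph n) → IsPath P → ∀ {m k} → m + k ≡ n → 2 + m ≤ k → 2 + m < n →
  Σ (Graph n) λ P′ → IsPath P′ × ¬ SameEdges P P′ × SameConnectedKSets k P P′
IsPath⇒swapped-path {n} P isPath@(σ , _) {m} {k} m+k≡n 2+m≤k 2+m<n =
  P′ , pathGraph-isPath π′ , different , same
  where
  1+m<n : suc m < n
  1+m<n = <-trans (n<1+n (suc m)) 2+m<n

  m<n : m < n
  m<n = <-trans (n<1+n m) 1+m<n

  π π′ : Permutation′ n
  π  = flip (⤖⇒↔ σ)
  π′ = π ∘ₚ transpose (fromℕ< m<n) (fromℕ< 1+m<n)

  P′ : Graph n
  P′ = pathGraph (position π′)

  position-π′ : ∀ x → position π′ x ≡ swapℕ m (position π x)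
  position-π′ x = toℕ-transpose (toℕ-fromℕ< m<n) (toℕ-fromℕ< 1+m<n) (π ⟨$⟩ʳ x)

  P≈Q : SameEdges P (pathGraph (position π))
  P≈Q = IsPath⇒pathGraph P isPath

  same : SameConnectedKSets k P P′
  same X = mk⇔
    (SameEdges⇒ConnectedKSet (pathGraph-cong (sym ∘ position-π′))
      ∘ SwapAdjacent.ConnectedKSet-swap π m+k≡n 2+m≤k
      ∘ SameEdges⇒ConnectedKSet P≈Q)
    (SameEdges⇒ConnectedKSet {G = pathGraph (position π)} (λ x y → sym (P≈Q x y))
      ∘ SameEdges⇒ConnectedKSet {G = pathGraph (swapℕ m ∘ position π′)} (pathGraph-cong swap-swap)
      ∘ SwapAdjacent.ConnectedKSet-swap π′ m+k≡n 2+m≤k)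
    where
    swap-swap : ∀ x → swapℕ m (position π′ x) ≡ position π x
    swap-swap x = trans (cong (swapℕ m) (position-π′ x)) (swapℕ-involutive m _)

  different : ¬ SameEdges P P′
  different P≈P′ = Consecutive-skip m
    (subst₂ Consecutive u↦m z↦2+m
      (Adj⇒Consecutive (position π) (subst T (P≈Q u z) (subst T (sym (P≈P′ u z)) uz′))))
    where
    u z : Fin n
    u = π ⟨$⟩ˡ fromℕ< m<n
    z = π ⟨$⟩ˡ fromℕ< 2+m<n
    u↦m : position π u ≡ m
    u↦m = trans (position-⟨$⟩ˡ π _) (toℕ-fromℕ< m<n)
    z↦2+m : position π z ≡ 2 + m
    z↦2+m = trans (position-⟨$⟩ˡ π _) (toℕ-fromℕ< 2+m<n)
    uz′ : Adj P′ u z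
    uz′ = Consecutive⇒Adj (position π′) (subst₂ Consecutive
      (sym (trans (position-π′ u) (trans (cong (swapℕ m) u↦m) (swapℕ-left m))))
      (sym (trans (position-π′ z) (trans (cong (swapℕ m) z↦2+m) (swapℕ-2+ m))))
      (inj₁ refl))

n+1≡r+⌈n/2⌉+⌈n/2⌉ : ∀ n → n + 1 ≡ (n + 1) % 2 + (⌈ n /2⌉ + ⌈ n /2⌉)
n+1≡r+⌈n/2⌉+⌈n/2⌉ n = begin
  n + 1                                   ≡⟨ m≡m%n+[m/n]*n (n + 1) 2 ⟩
  (n + 1) % 2 + ⌈ n /2⌉ * 2               ≡⟨ cong ((n + 1) % 2 +_) (*-comm ⌈ n /2⌉ 2) ⟩
  (n + 1) % 2 + (⌈ n /2⌉ + (⌈ n /2⌉ + 0)) ≡⟨ cong (λ h → (n + 1) % 2 + (⌈ n /2⌉ + h)) (+-identityʳ ⌈ n /2⌉) ⟩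
  (n + 1) % 2 + (⌈ n /2⌉ + ⌈ n /2⌉)       ∎
  where open ≡-Reasoning

⌈n/2⌉+⌈n/2⌉≤1+n : ∀ n → ⌈ n /2⌉ + ⌈ n /2⌉ ≤ suc n
⌈n/2⌉+⌈n/2⌉≤1+n n = subst (⌈ n /2⌉ + ⌈ n /2⌉ ≤_) (trans (sym (n+1≡r+⌈n/2⌉+⌈n/2⌉ n)) (+-comm n 1))
  (m≤n+m (⌈ n /2⌉ + ⌈ n /2⌉) ((n + 1) % 2))

n≤⌈n/2⌉+⌈n/2⌉ : ∀ n → n ≤ ⌈ n /2⌉ + ⌈ n /2⌉
n≤⌈n/2⌉+⌈n/2⌉ n = ≤-pred (subst (_≤ suc (⌈ n /2⌉ + ⌈ n /2⌉)) (trans (sym (n+1≡r+⌈n/2⌉+⌈n/2⌉ n)) (+-comm n 1))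
  (+-monoˡ-≤ (⌈ n /2⌉ + ⌈ n /2⌉) (≤-pred (m%n<n (n + 1) 2))))

upper-half-bounds : ∀ {n k} → 3 ≤ n → ⌈ n /2⌉ + 1 ≤ k → k ≤ n → 2 + (n ∸ k) ≤ k × 2 + (n ∸ k) < n
upper-half-bounds {n} {k} 3≤n above k≤n = 2+m≤k , 2+m<n
  where
  m = n ∸ k
  m+k≡n : m + k ≡ n
  m+k≡n = m∸n+n≡m k≤n
  n+2≤k+k : n + 2 ≤ k + k
  n+2≤k+k = ≤-trans (+-monoˡ-≤ 2 (n≤⌈n/2⌉+⌈n/2⌉ n))
              (subst (_≤ k + k) (twice ⌈ n /2⌉) (+-mono-≤ above above))
    where
    twice : ∀ q → (q + 1) + (q + 1) ≡ (q + q) + 2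
    twice = solve-∀
  2+m≤k : 2 + m ≤ k
  2+m≤k = +-cancelʳ-≤ k (2 + m) k (subst (_≤ k + k) (trans (+-comm n 2) (cong (2 +_) (sym m+k≡n))) n+2≤k+k)
  3≤k : 3 ≤ k
  3≤k = ≰⇒> λ k≤2 → <⇒≱ (≤-trans (+-monoˡ-≤ 2 3≤n) n+2≤k+k) (+-mono-≤ k≤2 k≤2)
  2+m<n : 2 + m < n
  2+m<n = subst (3 + m ≤_) (trans (+-comm k m) m+k≡n) (+-monoˡ-≤ m 3≤k)

theorem5 : (n : ℕ) → 3 ≤ n →
    ((k : ℕ) → 2 ≤ k → k ≤ ⌈ n /2⌉ →
      (T₁ T₂ : Graph n) → IsTree T₁ → IsTree T₂ → ¬ SameEdges T₁ T₂ →
      ¬ SameConnectedKSets k T₁ T₂)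
    ×
    ((k : ℕ) → ⌈ n /2⌉ + 1 ≤ k → k ≤ n →
      (P : Graph n) → IsPath P →
      Σ (Graph n) λ P′ → IsPath P′ × ¬ SameEdges P P′ × SameConnectedKSets k P P′)
theorem5 n 3≤n = part-a , part-b
  where
  part-a : (k : ℕ) → 2 ≤ k → k ≤ ⌈ n /2⌉ → (T₁ T₂ : Graph n) → IsTree T₁ → IsTree T₂ →
    ¬ SameEdges T₁ T₂ → ¬ SameConnectedKSets k T₁ T₂
  part-a k 2≤k k≤⌈n/2⌉ T₁ T₂ tree₁ tree₂ distinct =
    distinct ∘ SameConnectedKSets⇒SameEdges tree₁ tree₂ 2≤k
      (≤-trans (+-mono-≤ k≤⌈n/2⌉ k≤⌈n/2⌉) (⌈n/2⌉+⌈n/2⌉≤1+n n))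
  part-b : (k : ℕ) → ⌈ n /2⌉ + 1 ≤ k → k ≤ n → (P : Graph n) → IsPath P →
    Σ (Graph n) λ P′ → IsPath P′ × ¬ SameEdges P P′ × SameConnectedKSets k P P′
  part-b k above k≤n P isPath =
    let 2+m≤k , 2+m<n = upper-half-bounds 3≤n above k≤n
    in IsPath⇒swapped-path P isPath (m∸n+n≡m k≤n) 2+m≤k 2+m<n
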